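{- Let $O$ be a locally finite totally ordered set. The map $I\mapsto\widetilde I$ is an order isomorphism from $(\mathscr I^\infty_O,\supseteq)$ onto the poset (with the order of $\mathscr E_O$) of $\wedge$-irreducible elements of $\mathscr E_O$.
   Context: An interval of $O$ is a convex subset (including $\emptyset$ and $O$); $\mathscr I_O$ is the set of finite intervals, $\mathscr I^\infty_O$ the set of all intervals. $\mathscr E_O$ is the set of inclusion-antichains of elements of $\mathscr I_O$, ordered by $A\le B$ iff for every $I\in A$ there is $J\in B$ with $J\subseteq I$; its top is $1=\{\emptyset\}$. For $I\in\mathscr I^\infty_O$, $\widetilde I=\{\{x\}: x\in O\setminus I\}$. An element $x\ne1$ is $\wedge$-irreducible if $x=a\wedge b$ implies $x=a$ or $x=b$. -}

module Defs where

open import Level using (Level; 0ℓ; Setω) renaming (suc to lsuc)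
open import Data.Product using (Σ; ∃; _×_; _,_)
open import Data.Sum using (_⊎_)
open import Data.List using (List)
open import Data.List.Membership.Propositional using (_∈_)
open import Relation.Nullary using (¬_)
open import Data.Empty using (⊥)
open import Relation.Binary.PropositionalEquality using (_≡_)
open import Relation.Binary.Structures using (IsTotalOrder)
open import Axiom.ExcludedMiddle using (ExcludedMiddle)

-- Classical ambient logic (the paper is classical): excluded middle at every level.
LEM : Setω
LEM = ∀ {ℓ} → ExcludedMiddle ℓ

record LocallyFiniteTotalOrder : Set₁ where
  field
    Carrier     : Set
    _≤_         : Carrier → Carrier → Set
    isTotalOrder : IsTotalOrder _≡_ _≤_
    locallyFinite : ∀ a b → ∃ λ (xs : List Carrier) →
                      ∀ x → a ≤ x → x ≤ b → x ∈ xs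

module Theory (O : LocallyFiniteTotalOrder) where
  open LocallyFiniteTotalOrder O

  Subset : Set₁
  Subset = Carrier → Set

  _⊆_ : Subset → Subset → Set
  I ⊆ J = ∀ x → I x → J x

  _≐_ : Subset → Subset → Set
  I ≐ J = (I ⊆ J) × (J ⊆ I)

  ∅ : Subset
  ∅ _ = ⊥

  ｛_｝ : Carrier → Subset
  ｛ x ｝ y = y ≡ x

  -- interval = convex subset (∅ and O included)
  IsInterval : Subset → Set
  IsInterval I = ∀ x y z → x ≤ y → y ≤ z → I x → I z → I y

  IsFinite : Subset → Set
  IsFinite I = ∃ λ (xs : List Carrier) → ∀ x → I x → x ∈ xs

  IsFiniteInterval : Subset → Set
  IsFiniteInterval I = IsInterval I × IsFinite I

  Family : Set₁
  Family = Subset → Set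

  _≐ᶠ_ : Family → Family → Set₁
  A ≐ᶠ B = (∀ S → A S → B S) × (∀ S → B S → A S)

  -- 𝓔_O : inclusion-antichains of finite intervals (as sets of subsets,
  -- closed under extensional equality of subsets)
  record InE (A : Family) : Set₁ where
    field
      members-finite-intervals : ∀ I → A I → IsFiniteInterval I
      antichain : ∀ I J → A I → A J → I ⊆ J → I ≐ J
      ext-closed : ∀ I J → A I → I ≐ J → A J

  _≤ᴱ_ : Family → Family → Set₁
  A ≤ᴱ B = ∀ I → A I → ∃ λ J → B J × (J ⊆ I)

  𝟏 : Family
  𝟏 S = S ≐ ∅

  IsMeet : Family → Family → Family → Set₁
  IsMeet x a b = (x ≤ᴱ a) × (x ≤ᴱ b) ×
                 (∀ y → InE y → y ≤ᴱ a → y ≤ᴱ b → y ≤ᴱ x)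

  record MeetIrreducible (x : Family) : Set₁ where
    field
      inE : InE x
      not-top : ¬ (x ≐ᶠ 𝟏)
      irreducible : ∀ a b → InE a → InE b → IsMeet x a b → (x ≐ᶠ a) ⊎ (x ≐ᶠ b)

  tilde : Subset → Family
  tilde I S = ∃ λ x → ¬ I x × (S ≐ ｛ x ｝)

module Submission where

-- If Ĩ = a ∧ b with a, b ≠ Ĩ, then a and b each have
-- a member inside I, and adjoining to Ĩ the interval hull (within I) of these two
-- members gives a lower bound of a and b that is not below Ĩ.
-- Conversely let x be ∧-irreducible and let S, S' be finite intervals containing no
-- member of x. The joins x ∨ {S} and x ∨ {S'} are not x, so their meet is not x
-- either, which means that some interval containing S ∪ S' contains no member of x.
-- Cutting a member of x at two of its points this way shows that members are
-- singletons; applied to {z₁}, {z₃} ∉ x it shows that I = {p : {p} ∉ x} is an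
-- interval, and then Ĩ = x.

open import Defs
open import Data.Product using (∃; _×_; _,_; proj₁; proj₂)
open import Data.Sum using (_⊎_; inj₁; inj₂; [_,_]′)
open import Data.Empty using (⊥; ⊥-elim)
open import Data.List using ([]; _∷_; _++_)
open import Data.List.Relation.Unary.Any using (here)
open import Data.List.Relation.Unary.Any.Properties using (¬Any[])
import Data.List.Relation.Unary.All as All
open import Data.List.Membership.Propositional.Properties using (∈-++⁺ˡ; ∈-++⁺ʳ)
import Data.List.Extrema as Extrema
open import Relation.Nullary using (¬_; Dec; yes; no)
open import Relation.Unary using (_∩_; _∪_)
open import Relation.Binary.PropositionalEquality using (_≡_; refl; sym; trans)
open import Relation.Binary.Structures using (IsTotalOrder)
open import Relation.Binary.Bundles using (TotalOrder)

module IntervalFamilies (O : LocallyFiniteTotalOrder) where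
  open LocallyFiniteTotalOrder O
  open Theory O
  open IsTotalOrder isTotalOrder using (antisym) renaming (trans to ≤-trans)

  ≐-refl : ∀ {S} → S ≐ S
  ≐-refl = (λ _ s → s) , (λ _ s → s)

  ≐-sym : ∀ {S T} → S ≐ T → T ≐ S
  ≐-sym (f , g) = g , f

  ≐-trans : ∀ {S T U} → S ≐ T → T ≐ U → S ≐ U
  ≐-trans (f , g) (h , k) = (λ x s → h x (f x s)) , (λ x u → g x (k x u))

  ⊆-trans : ∀ {S T U} → S ⊆ T → T ⊆ U → S ⊆ U
  ⊆-trans f g x s = g x (f x s)

  segment : Carrier → Carrier → Subset
  segment m M z = m ≤ z × z ≤ M

  Below Above : Carrier → Subset
  Below t z = ¬ t ≤ z
  Above s z = ¬ z ≤ s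

  isFinite-⊆ : ∀ {S T} → S ⊆ T → IsFinite T → IsFinite S
  isFinite-⊆ S⊆T (xs , T⊆xs) = xs , λ x s → T⊆xs x (S⊆T x s)

  ∪-isFinite : ∀ {S T} → IsFinite S → IsFinite T → IsFinite (S ∪ T)
  ∪-isFinite (xs , S⊆xs) (ys , T⊆ys) =
    xs ++ ys , λ { x (inj₁ s) → ∈-++⁺ˡ (S⊆xs x s) ; x (inj₂ t) → ∈-++⁺ʳ xs (T⊆ys x t) }

  ∪-⊆ : ∀ {S T U} → S ⊆ U → T ⊆ U → (S ∪ T) ⊆ U
  ∪-⊆ S⊆U _ x (inj₁ s) = S⊆U x s
  ∪-⊆ _ T⊆U x (inj₂ t) = T⊆U x t

  isInterval-resp-≐ : ∀ {S T} → S ≐ T → IsInterval S → IsInterval T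
  isInterval-resp-≐ (f , g) iS x y z x≤y y≤z Tx Tz = f y (iS x y z x≤y y≤z (g x Tx) (g z Tz))

  isFiniteInterval-resp-≐ : ∀ {S T} → S ≐ T → IsFiniteInterval S → IsFiniteInterval T
  isFiniteInterval-resp-≐ S≐T (iS , fS) = isInterval-resp-≐ S≐T iS , isFinite-⊆ (proj₂ S≐T) fS

  ∩-isInterval : ∀ {S T} → IsInterval S → IsInterval T → IsInterval (S ∩ T)
  ∩-isInterval iS iT x y z x≤y y≤z (Sx , Tx) (Sz , Tz) =
    iS x y z x≤y y≤z Sx Sz , iT x y z x≤y y≤z Tx Tz

  ∩-isFiniteInterval : ∀ {S T} → IsFiniteInterval S → IsInterval T → IsFiniteInterval (S ∩ T)
  ∩-isFiniteInterval (iS , fS) iT = ∩-isInterval iS iT , isFinite-⊆ (λ _ → proj₁) fS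

  segment-isFiniteInterval : ∀ m M → IsFiniteInterval (segment m M)
  segment-isFiniteInterval m M =
    (λ { x y z x≤y y≤z (m≤x , _) (_ , z≤M) → ≤-trans m≤x x≤y , ≤-trans y≤z z≤M })
    , (proj₁ (locallyFinite m M) , λ { x (m≤x , x≤M) → proj₂ (locallyFinite m M) x m≤x x≤M })

  ｛｝-isFiniteInterval : ∀ p → IsFiniteInterval ｛ p ｝
  ｛｝-isFiniteInterval p =
    (λ { x y z x≤y y≤z refl refl → antisym y≤z x≤y }) , (p ∷ [] , λ x x≡p → here x≡p)

  Below-isInterval : ∀ t → IsInterval (Below t)
  Below-isInterval t x y z x≤y y≤z _ t≰z t≤y = t≰z (≤-trans t≤y y≤z)

  Above-isInterval : ∀ s → IsInterval (Above s)
  Above-isInterval s x y z x≤y y≤z x≰s _ y≤s = x≰s (≤-trans x≤y y≤s)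

  totalOrder : TotalOrder _ _ _
  totalOrder = record { isTotalOrder = isTotalOrder }

  isFinite⇒intervalHull : ∀ {S I} → IsInterval I → IsFinite S → S ⊆ I →
                          ∃ λ C → IsFiniteInterval C × S ⊆ C × C ⊆ I
  isFinite⇒intervalHull iI ([] , S⊆[]) S⊆I =
    ∅ , ((λ { _ _ _ _ _ () _ }) , ([] , λ _ ())) , (λ x s → ¬Any[] (S⊆[] x s)) , λ _ ()
  isFinite⇒intervalHull {S} {I} iI (d ∷ ds , S⊆xs) S⊆I =
    segment m M ∩ I , ∩-isFiniteInterval (segment-isFiniteInterval m M) iI , S⊆C , λ _ → proj₂
    where
    open Extrema totalOrder using (min; max; min≤xs; xs≤max)
    m M : Carrier
    m = min d (d ∷ ds)
    M = max d (d ∷ ds)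
    S⊆C : S ⊆ (segment m M ∩ I)
    S⊆C x s = (All.lookup (min≤xs d _) (S⊆xs x s) , All.lookup (xs≤max d _) (S⊆xs x s)) , S⊆I x s

  MemberWithin : Family → Subset → Set₁
  MemberWithin x S = ∃ λ T → x T × (T ⊆ S)

  ≤ᴱ-antisym : ∀ {a b} → InE a → InE b → a ≤ᴱ b → b ≤ᴱ a → a ≐ᶠ b
  ≤ᴱ-antisym ia ib a≤b b≤a = ⊆ᶠ ia ib a≤b b≤a , ⊆ᶠ ib ia b≤a a≤b
    where
    ⊆ᶠ : ∀ {a b} → InE a → InE b → a ≤ᴱ b → b ≤ᴱ a → ∀ S → a S → b S
    ⊆ᶠ ia ib a≤b b≤a S aS with a≤b S aS
    ... | T , bT , T⊆S with b≤a T bT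
    ... | U , aU , U⊆T = InE.ext-closed ib T S bT
      (T⊆S , ⊆-trans (proj₂ (InE.antichain ia U S aU aS (⊆-trans U⊆T T⊆S))) U⊆T)

  ¬MemberWithin-proper : ∀ {x S S' z} → InE x → x S → S' ⊆ S → S z → ¬ S' z →
                         ¬ MemberWithin x S'
  ¬MemberWithin-proper ix xS S'⊆S Sz z∉S' (T , xT , T⊆S') =
    z∉S' (T⊆S' _ (proj₂ (InE.antichain ix T _ xT xS (⊆-trans T⊆S' S'⊆S)) _ Sz))

  empty-member⇒≐𝟏 : ∀ {x S} → InE x → x S → (∀ z → ¬ S z) → x ≐ᶠ 𝟏
  empty-member⇒≐𝟏 ix xS S-empty =
    (λ T xT → (λ z Tz → S-empty z (proj₂ (InE.antichain ix _ T xS xT S⊆) z Tz)) , λ _ ())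
    , λ T T≐∅ → InE.ext-closed ix _ T xS (S⊆ , λ z Tz → ⊥-elim (proj₁ T≐∅ z Tz))
    where
    S⊆ : ∀ {T} → _ ⊆ T
    S⊆ z Sz = ⊥-elim (S-empty z Sz)

  tilde-inE : ∀ I → InE (tilde I)
  InE.members-finite-intervals (tilde-inE I) S (p , _ , S≐p) =
    isFiniteInterval-resp-≐ (≐-sym S≐p) (｛｝-isFiniteInterval p)
  InE.antichain (tilde-inE I) S T (p , _ , S≐p) (q , _ , T≐q) S⊆T =
    S⊆T , λ z Tz → proj₂ S≐p z (trans (proj₁ T≐q z Tz) (sym p≡q))
    where
    p≡q : p ≡ q
    p≡q = proj₁ T≐q p (S⊆T p (proj₂ S≐p p refl))
  InE.ext-closed (tilde-inE I) S T (p , p∉I , S≐p) S≐T = p , p∉I , ≐-trans (≐-sym S≐T) S≐p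

  tilde-≉𝟏 : ∀ I → ¬ (tilde I ≐ᶠ 𝟏)
  tilde-≉𝟏 I (_ , 𝟏⊆tilde) with 𝟏⊆tilde ∅ ≐-refl
  ... | p , _ , ∅≐p = proj₂ ∅≐p p refl

  ⊆⇒tilde-≤ᴱ : ∀ {I J} → J ⊆ I → tilde I ≤ᴱ tilde J
  ⊆⇒tilde-≤ᴱ J⊆I S (p , p∉I , S≐p) = S , (p , (λ p∈J → p∉I (J⊆I p p∈J)) , S≐p) , λ _ s → s

  ⊆⇒¬MemberWithin-tilde : ∀ {I S} → S ⊆ I → ¬ MemberWithin (tilde I) S
  ⊆⇒¬MemberWithin-tilde S⊆I (T , (p , p∉I , T≐p) , T⊆S) =
    p∉I (S⊆I p (T⊆S p (proj₂ T≐p p refl)))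

  -- The join of x with the one-element antichain {S} in 𝓔_O.
  insert : Family → Subset → Family
  insert x S T = (x T × ¬ (S ⊆ T)) ⊎ (T ≐ S)

  insert-inE : ∀ {x S} → InE x → IsFiniteInterval S → ¬ MemberWithin x S → InE (insert x S)
  InE.members-finite-intervals (insert-inE ix fS _) T (inj₁ (xT , _)) =
    InE.members-finite-intervals ix T xT
  InE.members-finite-intervals (insert-inE ix fS _) T (inj₂ T≐S) =
    isFiniteInterval-resp-≐ (≐-sym T≐S) fS
  InE.antichain (insert-inE ix _ _) T U (inj₁ (xT , _)) (inj₁ (xU , _)) = InE.antichain ix T U xT xU
  InE.antichain (insert-inE ix _ S-free) T U (inj₁ (xT , _)) (inj₂ U≐S) T⊆U =
    ⊥-elim (S-free (T , xT , ⊆-trans T⊆U (proj₁ U≐S)))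
  InE.antichain (insert-inE ix _ _) T U (inj₂ T≐S) (inj₁ (_ , S⊈U)) T⊆U =
    ⊥-elim (S⊈U (⊆-trans (proj₂ T≐S) T⊆U))
  InE.antichain (insert-inE ix _ _) T U (inj₂ T≐S) (inj₂ U≐S) _ = ≐-trans T≐S (≐-sym U≐S)
  InE.ext-closed (insert-inE ix _ _) T U (inj₁ (xT , S⊈T)) T≐U =
    inj₁ (InE.ext-closed ix T U xT T≐U , λ S⊆U → S⊈T (⊆-trans S⊆U (proj₂ T≐U)))
  InE.ext-closed (insert-inE ix _ _) T U (inj₂ T≐S) T≐U = inj₂ (≐-trans (≐-sym T≐U) T≐S)

  insert-≤ᴱ : ∀ {x S a} → x ≤ᴱ a → MemberWithin a S → insert x S ≤ᴱ a
  insert-≤ᴱ x≤a _ T (inj₁ (xT , _)) = x≤a T xT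
  insert-≤ᴱ _ (A , aA , A⊆S) T (inj₂ T≐S) = A , aA , ⊆-trans A⊆S (proj₂ T≐S)

module ClassicalIntervalFamilies (O : LocallyFiniteTotalOrder) (lem : LEM) where
  open LocallyFiniteTotalOrder O
  open Theory O
  open IsTotalOrder isTotalOrder using (total; antisym) renaming (refl to ≤-refl; trans to ≤-trans)
  open IntervalFamilies O

  dec : ∀ {ℓ} (P : Set ℓ) → Dec P
  dec P = lem

  dne : ∀ {ℓ} {P : Set ℓ} → ¬ ¬ P → P
  dne {P = P} ¬¬p with dec P
  ... | yes p = p
  ... | no ¬p = ⊥-elim (¬¬p ¬p)

  Below-∪-Above : ∀ {s t} → s ≤ t → ¬ s ≡ t → ∀ z → (Below t ∪ Above s) z
  Below-∪-Above {s} {t} s≤t s≢t z with dec (t ≤ z) | dec (z ≤ s)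
  ... | no t≰z | _ = inj₁ t≰z
  ... | yes _ | no z≰s = inj₂ z≰s
  ... | yes t≤z | yes z≤s = ⊥-elim (s≢t (antisym s≤t (≤-trans t≤z z≤s)))

  ¬MemberWithin-tilde⇒⊆ : ∀ {I S} → ¬ MemberWithin (tilde I) S → S ⊆ I
  ¬MemberWithin-tilde⇒⊆ {S = S} S-free z Sz =
    dne λ z∉I → S-free (｛ z ｝ , (z , z∉I , ≐-refl) , λ { _ refl → Sz })

  tilde-≤ᴱ⇒⊆ : ∀ {I J} → tilde I ≤ᴱ tilde J → J ⊆ I
  tilde-≤ᴱ⇒⊆ I≤J z z∈J =
    dne λ z∉I → ⊆⇒¬MemberWithin-tilde (λ { _ refl → z∈J }) (I≤J ｛ z ｝ (z , z∉I , ≐-refl))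

  ≰ᴱ-tilde⇒member-⊆ : ∀ {a I} → ¬ (a ≤ᴱ tilde I) → ∃ λ A → a A × A ⊆ I
  ≰ᴱ-tilde⇒member-⊆ {a} {I} a≰ with dec (∃ λ A → a A × ¬ MemberWithin (tilde I) A)
  ... | yes (A , aA , A-free) = A , aA , ¬MemberWithin-tilde⇒⊆ A-free
  ... | no ∄A = ⊥-elim (a≰ λ A aA → dne λ A-free → ∄A (A , aA , A-free))

  ≤ᴱ-insert : ∀ {x} S → x ≤ᴱ insert x S
  ≤ᴱ-insert S T xT with dec (S ⊆ T)
  ... | yes S⊆T = S , inj₂ ≐-refl , S⊆T
  ... | no S⊈T = T , inj₁ (xT , S⊈T) , λ _ t → t

  tilde-meetIrreducible : ∀ I → IsInterval I → MeetIrreducible (tilde I)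
  tilde-meetIrreducible I iI = record
    { inE = tilde-inE I ; not-top = tilde-≉𝟏 I ; irreducible = irreducible }
    where
    finite : ∀ {a A} → InE a → a A → IsFinite A
    finite ia aA = proj₂ (InE.members-finite-intervals ia _ aA)

    irreducible : ∀ a b → InE a → InE b → IsMeet (tilde I) a b → (tilde I ≐ᶠ a) ⊎ (tilde I ≐ᶠ b)
    irreducible a b ia ib (≤a , ≤b , greatest) with dec (a ≤ᴱ tilde I) | dec (b ≤ᴱ tilde I)
    ... | yes a≤ | _ = inj₁ (≤ᴱ-antisym (tilde-inE I) ia ≤a a≤)
    ... | no _ | yes b≤ = inj₂ (≤ᴱ-antisym (tilde-inE I) ib ≤b b≤)
    ... | no a≰ | no b≰ with ≰ᴱ-tilde⇒member-⊆ a≰ | ≰ᴱ-tilde⇒member-⊆ b≰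
    ... | A , aA , A⊆I | B , bB , B⊆I
      with isFinite⇒intervalHull iI (∪-isFinite (finite ia aA) (finite ib bB)) (∪-⊆ A⊆I B⊆I)
    ... | C , fC , A∪B⊆C , C⊆I = ⊥-elim (C-free (greatest Y Y-inE Y≤a Y≤b C (inj₂ ≐-refl)))
      where
      C-free : ¬ MemberWithin (tilde I) C
      C-free = ⊆⇒¬MemberWithin-tilde C⊆I
      Y : Family
      Y = insert (tilde I) C
      Y-inE : InE Y
      Y-inE = insert-inE (tilde-inE I) fC C-free
      Y≤a : Y ≤ᴱ a
      Y≤a = insert-≤ᴱ ≤a (A , aA , λ z Az → A∪B⊆C z (inj₁ Az))
      Y≤b : Y ≤ᴱ b
      Y≤b = insert-≤ᴱ ≤b (B , bB , λ z Bz → A∪B⊆C z (inj₂ Bz))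

  insert-isMeet : ∀ {x S S'} → (∀ Y → IsInterval Y → S ⊆ Y → S' ⊆ Y → MemberWithin x Y) →
                  IsMeet x (insert x S) (insert x S')
  insert-isMeet {x} {S} {S'} hull = ≤ᴱ-insert S , ≤ᴱ-insert S' , greatest
    where
    greatest : ∀ y → InE y → y ≤ᴱ insert x S → y ≤ᴱ insert x S' → y ≤ᴱ x
    greatest y iy y≤ y≤' Y yY with y≤ Y yY | y≤' Y yY
    ... | A , inj₁ (xA , _) , A⊆Y | _ = A , xA , A⊆Y
    ... | _ | B , inj₁ (xB , _) , B⊆Y = B , xB , B⊆Y
    ... | A , inj₂ A≐S , A⊆Y | B , inj₂ B≐S' , B⊆Y =
      hull Y (proj₁ (InE.members-finite-intervals iy Y yY))
        (⊆-trans (proj₂ A≐S) A⊆Y) (⊆-trans (proj₂ B≐S') B⊆Y)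

  module MeetIrreducibleElement {x : Family} (mi : MeetIrreducible x) where
    open MeetIrreducible mi

    ¬MemberWithin-hulls : ∀ {S S'} → IsFiniteInterval S → IsFiniteInterval S' →
      ¬ MemberWithin x S → ¬ MemberWithin x S' →
      ¬ (∀ Y → IsInterval Y → S ⊆ Y → S' ⊆ Y → MemberWithin x Y)
    ¬MemberWithin-hulls {S} {S'} fS fS' S-free S'-free hull
      with irreducible _ _ (insert-inE inE fS S-free) (insert-inE inE fS' S'-free) (insert-isMeet hull)
    ... | inj₁ (_ , ⊆x) = S-free (S , ⊆x S (inj₂ ≐-refl) , λ _ s → s)
    ... | inj₂ (_ , ⊆x) = S'-free (S' , ⊆x S' (inj₂ ≐-refl) , λ _ s → s)

    member-inhabited : ∀ {S} → x S → ∃ λ z → S z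
    member-inhabited xS = dne λ ∄z → not-top (empty-member⇒≐𝟏 inE xS λ z Sz → ∄z (z , Sz))

    member-subsingleton : ∀ {S s t} → x S → S s → S t → s ≡ t
    member-subsingleton {S} {s} {t} xS Ss St = dne λ s≢t → separated s≢t (total s t)
      where
      fS : IsFiniteInterval S
      fS = InE.members-finite-intervals inE S xS

      cut : ∀ {s t} → s ≤ t → S s → S t → ¬ s ≡ t → ⊥
      cut {s} {t} s≤t Ss St s≢t =
        ¬MemberWithin-hulls (∩-isFiniteInterval fS (Below-isInterval t))
          (∩-isFiniteInterval fS (Above-isInterval s))
          (¬MemberWithin-proper inE xS (λ _ → proj₁) St (λ (_ , t≰t) → t≰t ≤-refl))
          (¬MemberWithin-proper inE xS (λ _ → proj₁) Ss (λ (_ , s≰s) → s≰s ≤-refl))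
          λ Y _ lower⊆Y upper⊆Y → S , xS , λ z Sz →
            [ (λ t≰z → lower⊆Y z (Sz , t≰z)) , (λ z≰s → upper⊆Y z (Sz , z≰s)) ]′
              (Below-∪-Above s≤t s≢t z)

      separated : ¬ s ≡ t → s ≤ t ⊎ t ≤ s → ⊥
      separated s≢t (inj₁ s≤t) = cut s≤t Ss St s≢t
      separated s≢t (inj₂ t≤s) = cut t≤s St Ss λ t≡s → s≢t (sym t≡s)

    member-singleton : ∀ {S} → x S → ∃ λ q → S ≐ ｛ q ｝
    member-singleton xS with member-inhabited xS
    ... | q , Sq = q , (λ w Sw → member-subsingleton xS Sw Sq) , λ { _ refl → Sq }

    ¬MemberWithin-｛｝ : ∀ {w} → ¬ x ｛ w ｝ → ¬ MemberWithin x ｛ w ｝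
    ¬MemberWithin-｛｝ w∉x (T , xT , T⊆w) with member-singleton xT
    ... | q , T≐q with T⊆w q (proj₂ T≐q q refl)
    ...   | refl = w∉x (InE.ext-closed inE T ｛ q ｝ xT T≐q)

    NonMembers : Subset
    NonMembers p = ¬ x ｛ p ｝

    nonMembers-isInterval : IsInterval NonMembers
    nonMembers-isInterval z₁ z z₃ z₁≤z z≤z₃ z₁∉x z₃∉x xz =
      ¬MemberWithin-hulls (｛｝-isFiniteInterval z₁) (｛｝-isFiniteInterval z₃)
        (¬MemberWithin-｛｝ z₁∉x) (¬MemberWithin-｛｝ z₃∉x)
        λ Y iY z₁∈Y z₃∈Y →
          ｛ z ｝ , xz , λ { _ refl → iY z₁ z z₃ z₁≤z z≤z₃ (z₁∈Y z₁ refl) (z₃∈Y z₃ refl) }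

    tilde-nonMembers : tilde NonMembers ≐ᶠ x
    tilde-nonMembers =
      (λ { S (p , ¬p∉x , S≐p) → InE.ext-closed inE ｛ p ｝ S (dne ¬p∉x) (≐-sym S≐p) })
      , λ S xS → let (q , S≐q) = member-singleton xS in
          q , (λ q∉x → q∉x (InE.ext-closed inE S ｛ q ｝ xS S≐q)) , S≐q

proposition14 : (O : LocallyFiniteTotalOrder) → LEM →
    let open Theory O in
    (∀ I → IsInterval I → MeetIrreducible (tilde I)) ×
    (∀ I J → IsInterval I → IsInterval J →
    ((J ⊆ I) → (tilde I ≤ᴱ tilde J)) × ((tilde I ≤ᴱ tilde J) → (J ⊆ I))) ×
    (∀ x → MeetIrreducible x → ∃ λ I → IsInterval I × (tilde I ≐ᶠ x))
proposition14 O lem =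
  tilde-meetIrreducible
  , (λ I J _ _ → ⊆⇒tilde-≤ᴱ , tilde-≤ᴱ⇒⊆)
  , λ x mi → let open MeetIrreducibleElement mi in
      NonMembers , nonMembers-isInterval , tilde-nonMembers
  where
  open IntervalFamilies O
  open ClassicalIntervalFamilies O lem
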